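{- Let $X$ and $Y$ be states of graphs $G$ and $H$, and let $f:U(X)\to U(Y)$ be a graph isomorphism such that the induced map $a_f((v,w))=(f(v),f(w))$ is a bijection $A(U(X))\to A(U(Y))$. Suppose $f\big(h(X)\cup L(G)\big)=h(Y)\cup L(H)$ and $f\big(t(X)\cup L(G)\big)=t(Y)\cup L(H)$. Then $a_f$ is a state isomorphism from $X$ to $Y$.
   Context: Graphs are finite, simple, without isolated vertices. For a graph $G$, $A(G)$ is the set of arrows $(v,w)$ with $\{v,w\}\in E(G)$; the flip sends $(v,w)$ to $(w,v)$. A decoration is a set of arrows containing at most one of $(v,w),(w,v)$ per edge. A vertex $w$ is a sink of a decoration $X$ if $(v,w)\in X$ for all neighbors $v$ of $w$, a source if $(w,v)\in X$ for all neighbors $v$. $L(G)$ is the set of leaves (degree-1 vertices) of $G$; other vertices are internal. A state is a decoration with no sink or source at an internal vertex. A follower of a state $X$ is a state $X\cup\{(v,w)\}$ with $\{v,w\}$ unmarked in $X$; descendents are iterated followers. $U(X)$ is the subgraph of $G$ induced by the edges carrying no arrow of $X$. For a bijection $a:A(U(X))\to A(U(Y))$, $a^+(X^*)=Y\cup a(X^*\setminus X)$ for decorations $X^*\supseteq X$. A state isomorphism from $X$ to $Y$ is a bijection $a:A(U(X))\to A(U(Y))$ commuting with the flip such that $a^+$ restricts to a bijection from the descendents of $X$ onto the descendents of $Y$. A vertex $v$ of $U(X)$ is a head of $X$ if $(w,v)\in X$ for some $w$, and a tail of $X$ if $(v,w)\in X$ for some $w$; $h(X)$, $t(X)$ denote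 the sets of heads and tails. Since $f$ is defined only on $V(U(X))$, in the hypotheses $f(S)$ means $\{f(s): s\in S\cap V(U(X))\}$ and the right-hand sides are intersected with $V(U(Y))$. -}

module Defs where

open import Data.Nat using (ℕ; zero; suc)
open import Data.Fin using (Fin; _≟_)
open import Data.Bool using (Bool; true; false; _∧_; _∨_; not; if_then_else_)
open import Data.List using (List; allFin; map)
open import Data.Nat.ListAction using (sum)
open import Data.Bool.ListAction using (any)
open import Data.Product using (Σ; ∃; _×_; _,_; proj₁; proj₂)
open import Data.Sum using (_⊎_)
open import Relation.Nullary using (¬_)
open import Relation.Nullary.Decidable using (⌊_⌋)
open import Relation.Binary.PropositionalEquality using (_≡_)
open import Function.Bundles using (_⇔_)

record Graph : Set where
  field
    n          : ℕ
    E          : Fin n → Fin n → Bool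
    E-sym      : ∀ v w → E v w ≡ E w v
    E-irrefl   : ∀ v → E v v ≡ false
    noIsolated : ∀ v → ∃ λ w → E v w ≡ true

open Graph public

V : Graph → Set
V G = Fin (n G)

PairSet : Graph → Set
PairSet G = V G → V G → Bool

_≐_ : ∀ {G : Graph} → PairSet G → PairSet G → Set
_≐_ {G} X Z = ∀ v w → X v w ≡ Z v w

Adj : (G : Graph) → V G → V G → Set
Adj G v w = E G v w ≡ true

degree : (G : Graph) → V G → ℕ
degree G v = sum (map (λ w → if E G v w then 1 else 0) (allFin (n G)))

Leaf : (G : Graph) → V G → Set
Leaf G v = degree G v ≡ 1

Internal : (G : Graph) → V G → Set
Internal G v = ¬ Leaf G v

IsDecoration : (G : Graph) → PairSet G → Set
IsDecoration G X =
  (∀ v w → X v w ≡ true → Adj G v w) × (∀ v w → X v w ≡ true → X w v ≡ false)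

Sink : (G : Graph) → PairSet G → V G → Set
Sink G X w = ∀ v → Adj G v w → X v w ≡ true

Source : (G : Graph) → PairSet G → V G → Set
Source G X w = ∀ v → Adj G w v → X w v ≡ true

IsState : (G : Graph) → PairSet G → Set
IsState G X =
  IsDecoration G X × (∀ w → Internal G w → ¬ Sink G X w × ¬ Source G X w)

-- edge {v,w} unmarked in X, i.e. an arrow (v,w) of U(X)
UArrow : (G : Graph) → PairSet G → V G → V G → Set
UArrow G X v w = Adj G v w × X v w ≡ false × X w v ≡ false

uArrowB : (G : Graph) → PairSet G → V G → V G → Bool
uArrowB G X v w = E G v w ∧ not (X v w) ∧ not (X w v)

InU : (G : Graph) → PairSet G → V G → Set
InU G X v = ∃ λ w → UArrow G X v w

Follower : (G : Graph) → PairSet G → PairSet G → Set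
Follower G X Z =
  IsState G Z ×
  (Σ (V G) λ v → Σ (V G) λ w → UArrow G X v w ×
     (∀ p q → Z p q ≡ (X p q ∨ (⌊ p ≟ v ⌋ ∧ ⌊ q ≟ w ⌋))))

data Desc (G : Graph) (X : PairSet G) : PairSet G → Set where
  step : ∀ {Z} → Follower G X Z → Desc G X Z
  more : ∀ {Z W} → Desc G X Z → Follower G Z W → Desc G X W

Head : (G : Graph) → PairSet G → V G → Set
Head G X v = InU G X v × ∃ λ w → X w v ≡ true

Tail : (G : Graph) → PairSet G → V G → Set
Tail G X v = InU G X v × ∃ λ w → X v w ≡ true

-- maps on arrows, represented as total maps on pairs; only their values on
-- A(U(X)) matter.
ArrowMap : Graph → Graph → Set
ArrowMap G H = V G × V G → V H × V H

swap : ∀ {A : Set} → A × A → A × A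
swap (x , y) = (y , x)

ArrowBij : (G H : Graph) → PairSet G → PairSet H → ArrowMap G H → Set
ArrowBij G H X Y a =
  (∀ v w → UArrow G X v w → UArrow H Y (proj₁ (a (v , w))) (proj₂ (a (v , w)))) ×
  (∀ v w v' w' → UArrow G X v w → UArrow G X v' w' →
     a (v , w) ≡ a (v' , w') → (v , w) ≡ (v' , w')) ×
  (∀ v' w' → UArrow H Y v' w' →
     ∃ λ v → ∃ λ w → UArrow G X v w × a (v , w) ≡ (v' , w'))

FlipComm : (G H : Graph) → PairSet G → ArrowMap G H → Set
FlipComm G H X a = ∀ v w → UArrow G X v w → a (w , v) ≡ swap (a (v , w))

-- a⁺(X*) = Y ∪ a(X* \ X)
aPlus : (G H : Graph) → PairSet G → PairSet H → ArrowMap G H → PairSet G → PairSet H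
aPlus G H X Y a Xs v' w' =
  Y v' w' ∨
  any (λ v → any (λ w →
         uArrowB G X v w ∧ Xs v w ∧ not (X v w) ∧
         ⌊ proj₁ (a (v , w)) ≟ v' ⌋ ∧ ⌊ proj₂ (a (v , w)) ≟ w' ⌋)
       (allFin (n G)))
      (allFin (n G))

StateIso : (G H : Graph) → PairSet G → PairSet H → ArrowMap G H → Set
StateIso G H X Y a =
  ArrowBij G H X Y a × FlipComm G H X a ×
  (∀ D → Desc G X D → Desc H Y (aPlus G H X Y a D)) ×
  (∀ D D' → Desc G X D → Desc G X D' →
     _≐_ {H} (aPlus G H X Y a D) (aPlus G H X Y a D') → _≐_ {G} D D') ×
  (∀ Z → Desc H Y Z → ∃ λ D → Desc G X D × _≐_ {H} (aPlus G H X Y a D) Z)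

-- f : V(U(X)) → V(U(Y)) is a graph isomorphism U(X) → U(Y)
-- (f is a total map on V G; only its values on V(U(X)) matter)
GraphIsoU : (G H : Graph) → PairSet G → PairSet H → (V G → V H) → Set
GraphIsoU G H X Y f =
  (∀ v → InU G X v → InU H Y (f v)) ×
  (∀ v v' → InU G X v → InU G X v' → f v ≡ f v' → v ≡ v') ×
  (∀ u → InU H Y u → ∃ λ v → InU G X v × f v ≡ u) ×
  (∀ v w → InU G X v → InU G X w → (UArrow G X v w ⇔ UArrow H Y (f v) (f w)))

af : (G H : Graph) → (V G → V H) → ArrowMap G H
af G H f (v , w) = (f v , f w)

-- f(S ∪ L(G)) = (S' ∪ L(H)) ∩ V(U(Y)), with f(S) taken over S ∩ V(U(X))
ImageCond : (G H : Graph) → PairSet G → PairSet H → (V G → V H) →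
            (V G → Set) → (V H → Set) → Set
ImageCond G H X Y f S S' =
  ∀ u → (∃ λ s → InU G X s × (S s ⊎ Leaf G s) × f s ≡ u) ⇔
        (InU H Y u × (S' u ⊎ Leaf H u))

-- Every descendent D of X satisfies X ⊆ D ⊆ X ∪ A(U(X)); on such decorations
-- a⁺ just relabels the arrows of D ∖ X through f, so it is injective, and adding
-- one arrow commutes with it. Followers therefore correspond to followers as
-- soon as a⁺ preserves and reflects the state condition. At an internal vertex
-- outside U(X) (resp. U(Y)) every edge is already marked, so a sink or source
-- there would be one of X (resp. Y). At v in U(X), a sink of D at v forces v
-- not to be a tail of X, and the hypothesis on tails and leaves says that f v is
-- then neither a tail of Y nor a leaf, so the sink is carried over to f v; the
-- converse and the case of sources and heads are the same.
module Submission where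

open import Defs
open import Data.Nat using (ℕ)
open import Data.Bool using (Bool; true; false; _∧_; _∨_; not)
open import Data.Bool.Properties using (T-≡; not-¬; ¬-not) renaming (_≟_ to _≟ᵇ_)
open import Data.Bool.ListAction using (any)
open import Data.Fin using (Fin; _≟_)
open import Data.Fin.Properties using (any?)
open import Data.List using (List; allFin)
open import Data.List.Membership.Propositional using (lose)
open import Data.List.Membership.Propositional.Properties using (∈-allFin)
open import Data.List.Relation.Unary.Any using (satisfied)
open import Data.List.Relation.Unary.Any.Properties using (any⁺; any⁻)
open import Data.Product using (Σ; ∃; ∃₂; _×_; _,_; proj₁; proj₂; map₂)
open import Data.Sum using (_⊎_; inj₁; inj₂; [_,_])
open import Function using (_∘_)
open import Function.Bundles using (_⇔_; mk⇔; Equivalence)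
open import Relation.Nullary using (¬_; Dec; yes; no; contradiction)
open import Relation.Nullary.Decidable using (⌊_⌋; _×-dec_; toWitness; fromWitness)
open import Relation.Binary.PropositionalEquality
  using (_≡_; refl; sym; trans; cong; cong₂; subst)

private variable
  a b : Bool
  m : ℕ

≡true-ext : (a ≡ true → b ≡ true) → (b ≡ true → a ≡ true) → a ≡ b
≡true-ext {false} {false} _ _ = refl
≡true-ext {false} {true} _ b⇒a = b⇒a refl
≡true-ext {true} {false} a⇒b _ = sym (a⇒b refl)
≡true-ext {true} {true} _ _ = refl

∧-true : a ∧ b ≡ true → a ≡ true × b ≡ true
∧-true {true} b≡true = refl , b≡true

true-∧ : a ≡ true → b ≡ true → a ∧ b ≡ true
true-∧ refl b≡true = b≡true

∨-true : a ∨ b ≡ true → a ≡ true ⊎ b ≡ true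
∨-true {true} _ = inj₁ refl
∨-true {false} b≡true = inj₂ b≡true

∨-trueˡ : a ≡ true → a ∨ b ≡ true
∨-trueˡ refl = refl

∨-trueʳ : b ≡ true → a ∨ b ≡ true
∨-trueʳ {a = true} _ = refl
∨-trueʳ {a = false} b≡true = b≡true

not-true : not a ≡ true → a ≡ false
not-true {false} _ = refl

false-not : a ≡ false → not a ≡ true
false-not refl = refl

≟-true⇒≡ : {i j : Fin m} → ⌊ i ≟ j ⌋ ≡ true → i ≡ j
≟-true⇒≡ {i = i} {j} = toWitness {a? = i ≟ j} ∘ Equivalence.from T-≡

≟-refl : (i : Fin m) → ⌊ i ≟ i ⌋ ≡ true
≟-refl i = Equivalence.to T-≡ (fromWitness {a? = i ≟ i} refl)

any-true⇒∃ : {A : Set} (p : A → Bool) (xs : List A) → any p xs ≡ true → ∃ λ x → p x ≡ true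
any-true⇒∃ p xs = map₂ (Equivalence.to T-≡) ∘ satisfied ∘ any⁻ p xs ∘ Equivalence.from T-≡

any-allFin : (p : Fin m → Bool) (i : Fin m) → p i ≡ true → any p (allFin m) ≡ true
any-allFin p i = Equivalence.to T-≡ ∘ any⁺ p ∘ lose (∈-allFin i) ∘ Equivalence.from T-≡

_⊆_ : (X D : Fin m → Fin m → Bool) → Set
X ⊆ D = ∀ p q → X p q ≡ true → D p q ≡ true

addArrow : (Fin m → Fin m → Bool) → Fin m → Fin m → Fin m → Fin m → Bool
addArrow W v w p q = W p q ∨ (⌊ p ≟ v ⌋ ∧ ⌊ q ≟ w ⌋)

addArrow-true : ∀ {W : Fin m → Fin m → Bool} {v w p q} →
                addArrow W v w p q ≡ true → W p q ≡ true ⊎ (p ≡ v × q ≡ w)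
addArrow-true {W = W} {p = p} e with ∨-true {W p _} e
... | inj₁ old = inj₁ old
... | inj₂ new = inj₂ (≟-true⇒≡ (proj₁ (∧-true new)) , ≟-true⇒≡ (proj₂ (∧-true {⌊ p ≟ _ ⌋} new)))

addArrow-new : ∀ (W : Fin m → Fin m → Bool) v w → addArrow W v w v w ≡ true
addArrow-new W v w = ∨-trueʳ {a = W v w} (true-∧ (≟-refl v) (≟-refl w))

≐-syntax : (G : Graph) → PairSet G → PairSet G → Set
≐-syntax G = _≐_ {G}

syntax ≐-syntax G X Z = X ≐[ G ] Z

module _ (G : Graph) where

  Adj-sym : ∀ {v w} → Adj G v w → Adj G w v
  Adj-sym {v} {w} = trans (E-sym G w v)

  UArrow-sym : ∀ X {v w} → UArrow G X v w → UArrow G X w v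
  UArrow-sym _ (vw , Xvw , Xwv) = Adj-sym vw , Xwv , Xvw

  UArrow-antitone : ∀ {X W v w} → X ⊆ W → UArrow G W v w → UArrow G X v w
  UArrow-antitone {v = v} {w} X⊆W (vw , Wvw , Wwv) =
    vw , ¬-not (λ x → not-¬ (X⊆W v w x) Wvw) , ¬-not (λ x → not-¬ (X⊆W w v x) Wwv)

  uArrowB⇒UArrow : ∀ X v w → uArrowB G X v w ≡ true → UArrow G X v w
  uArrowB⇒UArrow X v w e with ∧-true {E G v w} e
  ... | vw , rest with ∧-true {not (X v w)} rest
  ... | Xvw , Xwv = vw , not-true Xvw , not-true Xwv

  UArrow⇒uArrowB : ∀ X v w → UArrow G X v w → uArrowB G X v w ≡ true
  UArrow⇒uArrowB X v w (vw , Xvw , Xwv) = true-∧ vw (true-∧ (false-not Xvw) (false-not Xwv))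

  UArrow? : ∀ X v w → Dec (UArrow G X v w)
  UArrow? X v w = (E G v w ≟ᵇ true) ×-dec ((X v w ≟ᵇ false) ×-dec (X w v ≟ᵇ false))

  InU? : ∀ X v → Dec (InU G X v)
  InU? X v = any? (UArrow? X v)

  IsState-resp-≐ : ∀ {Z Z′} → Z ≐[ G ] Z′ → IsState G Z → IsState G Z′
  IsState-resp-≐ Z≐Z′ ((adj , anti) , noSinkSource) =
    ((λ v w → adj v w ∘ trans (Z≐Z′ v w)) ,
     (λ v w → trans (sym (Z≐Z′ w v)) ∘ anti v w ∘ trans (Z≐Z′ v w))) ,
    (λ w int → (λ sink → proj₁ (noSinkSource w int) (λ v → trans (Z≐Z′ v w) ∘ sink v)) ,
               (λ source → proj₂ (noSinkSource w int) (λ v → trans (Z≐Z′ w v) ∘ source v)))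

  Follower-respˡ-≐ : ∀ {W W′ Z} → W ≐[ G ] W′ → Follower G W Z → Follower G W′ Z
  Follower-respˡ-≐ W≐W′ (stZ , v , w , (vw , Wvw , Wwv) , Z≐) =
    stZ , v , w , (vw , trans (sym (W≐W′ v w)) Wvw , trans (sym (W≐W′ w v)) Wwv) ,
    (λ p q → trans (Z≐ p q) (cong (_∨ _) (W≐W′ p q)))

  marked-or-UArrow : ∀ X {v w} → Adj G v w → X v w ≡ true ⊎ X w v ≡ true ⊎ UArrow G X v w
  marked-or-UArrow X {v} {w} vw with X v w | X w v
  ... | true | _ = inj₁ refl
  ... | false | true = inj₂ (inj₁ refl)
  ... | false | false = inj₂ (inj₂ (vw , refl , refl))

  sink-outside-U : ∀ {Y Z u} → IsDecoration G Z → Y ⊆ Z → ¬ InU G Y u → Sink G Z u → Sink G Y u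
  sink-outside-U {Y} {u = u} (_ , anti) Y⊆Z u∉U sink p pu with marked-or-UArrow Y pu
  ... | inj₁ Ypu = Ypu
  ... | inj₂ (inj₁ Yup) = contradiction (sink p pu) (not-¬ (anti u p (Y⊆Z u p Yup)))
  ... | inj₂ (inj₂ u) = contradiction (p , UArrow-sym Y u) u∉U

  source-outside-U : ∀ {Y Z u} → IsDecoration G Z → Y ⊆ Z → ¬ InU G Y u → Source G Z u → Source G Y u
  source-outside-U {Y} {u = u} (_ , anti) Y⊆Z u∉U source p up with marked-or-UArrow Y up
  ... | inj₁ Yup = Yup
  ... | inj₂ (inj₁ Ypu) = contradiction (source p up) (not-¬ (anti p u (Y⊆Z p u Ypu)))
  ... | inj₂ (inj₂ u) = contradiction (p , u) u∉U

  Sink⇒¬Tail : ∀ {Y Z v} → IsDecoration G Z → Y ⊆ Z → Sink G Z v → ¬ Tail G Y v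
  Sink⇒¬Tail {v = v} (adj , anti) Y⊆Z sink (_ , w , Yvw) =
    not-¬ (sink w (Adj-sym (adj v w Zvw))) (anti v w Zvw)
    where Zvw = Y⊆Z v w Yvw

  Source⇒¬Head : ∀ {Y Z v} → IsDecoration G Z → Y ⊆ Z → Source G Z v → ¬ Head G Y v
  Source⇒¬Head {v = v} (adj , anti) Y⊆Z source (_ , w , Ywv) =
    not-¬ (source w (Adj-sym (adj w v Zwv))) (anti w v Zwv)
    where Zwv = Y⊆Z w v Ywv

  record Extends (X D : PairSet G) : Set where
    field
      base-⊆ : X ⊆ D
      ⊆-base∪U : ∀ p q → D p q ≡ true → X p q ≡ true ⊎ UArrow G X p q

  open Extends public

  Extends-refl : ∀ {X} → Extends X X
  Extends-refl = record { base-⊆ = λ _ _ x → x ; ⊆-base∪U = λ _ _ → inj₁ }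

  Extends-step : ∀ {X W Z v w} → Extends X W → UArrow G X v w →
                 Z ≐[ G ] addArrow W v w → Extends X Z
  Extends-step {X} {W} {Z} ext uX Z≐ = record
    { base-⊆ = λ p q → trans (Z≐ p q) ∘ ∨-trueˡ ∘ base-⊆ ext p q
    ; ⊆-base∪U = ⊆-base∪U′
    }
    where
    ⊆-base∪U′ : ∀ p q → Z p q ≡ true → X p q ≡ true ⊎ UArrow G X p q
    ⊆-base∪U′ p q Zpq with addArrow-true {W = W} (trans (sym (Z≐ p q)) Zpq)
    ... | inj₁ Wpq = ⊆-base∪U ext p q Wpq
    ... | inj₂ (refl , refl) = inj₂ uX

  Desc⇒Extends : ∀ {X D} → Desc G X D → Extends X D
  Desc⇒Extends (step (_ , _ , _ , uX , Z≐)) = Extends-step Extends-refl uX Z≐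
  Desc⇒Extends (more d (_ , _ , _ , uW , Z≐)) =
    Extends-step ext (UArrow-antitone (base-⊆ ext) uW) Z≐
    where ext = Desc⇒Extends d

module ArrowImage (G H : Graph) (X : PairSet G) (Y : PairSet H) (f : V G → V H)
                  (bij : ArrowBij G H X Y (af G H f)) where

  a⁺ : PairSet G → PairSet H
  a⁺ = aPlus G H X Y (af G H f)

  f-UArrow : ∀ {v w} → UArrow G X v w → UArrow H Y (f v) (f w)
  f-UArrow = proj₁ bij _ _

  f-UArrow-injective : ∀ {v w v′ w′} → UArrow G X v w → UArrow G X v′ w′ →
                       f v ≡ f v′ → f w ≡ f w′ → (v , w) ≡ (v′ , w′)
  f-UArrow-injective u u′ eq₁ eq₂ = proj₁ (proj₂ bij) _ _ _ _ u u′ (cong₂ _,_ eq₁ eq₂)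

  ImageArrow : PairSet G → V H → V H → Set
  ImageArrow D p q = Σ (V G) λ v → Σ (V G) λ w →
    UArrow G X v w × D v w ≡ true × f v ≡ p × f w ≡ q

  a⁺-true : ∀ D p q → a⁺ D p q ≡ true → Y p q ≡ true ⊎ ImageArrow D p q
  a⁺-true D p q e with ∨-true {Y p q} e
  ... | inj₁ Ypq = inj₁ Ypq
  ... | inj₂ r with any-true⇒∃ _ (allFin (n G)) r
  ... | v , r′ with any-true⇒∃ _ (allFin (n G)) r′
  ... | w , c with ∧-true {uArrowB G X v w} c
  ... | u , c₁ with ∧-true {D v w} c₁
  ... | Dvw , c₂ with ∧-true {⌊ f v ≟ p ⌋} (proj₂ (∧-true {not (X v w)} c₂))
  ... | fv≡p , fw≡q =
    inj₂ (v , w , uArrowB⇒UArrow G X v w u , Dvw , ≟-true⇒≡ fv≡p , ≟-true⇒≡ fw≡q)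

  Y⊆a⁺ : ∀ D → Y ⊆ a⁺ D
  Y⊆a⁺ _ _ _ = ∨-trueˡ

  a⁺-image : ∀ D {v w} → UArrow G X v w → D v w ≡ true → a⁺ D (f v) (f w) ≡ true
  a⁺-image D {v} {w} u Dvw =
    ∨-trueʳ {a = Y (f v) (f w)} (any-allFin _ v (any-allFin _ w
      (true-∧ (UArrow⇒uArrowB G X v w u) (true-∧ Dvw (true-∧ (false-not (proj₁ (proj₂ u)))
        (true-∧ (≟-refl (f v)) (≟-refl (f w))))))))

  a⁺-reflects : ∀ D {v w} → UArrow G X v w → a⁺ D (f v) (f w) ≡ true → D v w ≡ true
  a⁺-reflects D u e with a⁺-true D _ _ e
  ... | inj₁ Yfvfw = contradiction (proj₁ (proj₂ (f-UArrow u))) (not-¬ Yfvfw)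
  ... | inj₂ (v′ , w′ , u′ , Dv′w′ , eq₁ , eq₂) with f-UArrow-injective u′ u eq₁ eq₂
  ... | refl = Dv′w′

  a⁺-unmarked : ∀ D {v w} → UArrow G X v w → D v w ≡ false → a⁺ D (f v) (f w) ≡ false
  a⁺-unmarked D u Dvw = ¬-not (λ e → not-¬ (a⁺-reflects D u e) Dvw)

  a⁺-base : a⁺ X ≐[ H ] Y
  a⁺-base p q = ≡true-ext onlyY (Y⊆a⁺ X p q)
    where
    onlyY : a⁺ X p q ≡ true → Y p q ≡ true
    onlyY e with a⁺-true X p q e
    ... | inj₁ Ypq = Ypq
    ... | inj₂ (_ , _ , (_ , Xvw≡false , _) , Xvw , _) = contradiction Xvw≡false (not-¬ Xvw)

  a⁺-addArrow : ∀ {D Z v w} → UArrow G X v w → Z ≐[ G ] addArrow D v w →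
                a⁺ Z ≐[ H ] addArrow (a⁺ D) (f v) (f w)
  a⁺-addArrow {D} {Z} {v} {w} uX Z≐ p q = ≡true-ext to from
    where
    to : a⁺ Z p q ≡ true → addArrow (a⁺ D) (f v) (f w) p q ≡ true
    to e with a⁺-true Z p q e
    ... | inj₁ Ypq = ∨-trueˡ (Y⊆a⁺ D p q Ypq)
    ... | inj₂ (v′ , w′ , u′ , Zv′w′ , refl , refl)
          with addArrow-true {W = D} (trans (sym (Z≐ v′ w′)) Zv′w′)
    ...   | inj₁ Dv′w′ = ∨-trueˡ (a⁺-image D u′ Dv′w′)
    ...   | inj₂ (refl , refl) = addArrow-new (a⁺ D) (f v) (f w)
    from : addArrow (a⁺ D) (f v) (f w) p q ≡ true → a⁺ Z p q ≡ true
    from e with addArrow-true {W = a⁺ D} e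
    ... | inj₂ (refl , refl) = a⁺-image Z uX (trans (Z≐ v w) (addArrow-new D v w))
    ... | inj₁ a⁺Dpq with a⁺-true D p q a⁺Dpq
    ...   | inj₁ Ypq = Y⊆a⁺ Z p q Ypq
    ...   | inj₂ (v′ , w′ , u′ , Dv′w′ , refl , refl) =
            a⁺-image Z u′ (trans (Z≐ v′ w′) (∨-trueˡ Dv′w′))

  a⁺-decoration : ∀ {D} → IsDecoration H Y → IsDecoration G D → IsDecoration H (a⁺ D)
  a⁺-decoration {D} (adjY , antiY) (_ , antiD) = adj , λ p q → ¬-not ∘ anti p q
    where
    adj : ∀ p q → a⁺ D p q ≡ true → Adj H p q
    adj p q e with a⁺-true D p q e
    ... | inj₁ Ypq = adjY p q Ypq
    ... | inj₂ (_ , _ , u , _ , refl , refl) = proj₁ (f-UArrow u)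
    anti : ∀ p q → a⁺ D p q ≡ true → ¬ a⁺ D q p ≡ true
    anti p q e e′ with a⁺-true D p q e | a⁺-true D q p e′
    ... | inj₁ Ypq | inj₁ Yqp = not-¬ Yqp (antiY p q Ypq)
    ... | inj₁ Ypq | inj₂ (_ , _ , u , _ , refl , refl) = not-¬ Ypq (proj₂ (proj₂ (f-UArrow u)))
    ... | inj₂ (_ , _ , u , _ , refl , refl) | inj₁ Yqp = not-¬ Yqp (proj₂ (proj₂ (f-UArrow u)))
    ... | inj₂ (v , w , u , Dvw , refl , refl) | inj₂ _ =
      not-¬ (a⁺-reflects D (UArrow-sym G X u) e′) (antiD v w Dvw)

  a⁺-decoration⁻¹ : ∀ {D} → IsDecoration G X → Extends G X D → IsDecoration H (a⁺ D) →
                    IsDecoration G D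
  a⁺-decoration⁻¹ {D} (adjX , antiX) ext (_ , antiH) = adj , λ p q → ¬-not ∘ anti p q
    where
    adj : ∀ p q → D p q ≡ true → Adj G p q
    adj p q Dpq with ⊆-base∪U ext p q Dpq
    ... | inj₁ Xpq = adjX p q Xpq
    ... | inj₂ u = proj₁ u
    anti : ∀ p q → D p q ≡ true → ¬ D q p ≡ true
    anti p q Dpq Dqp with ⊆-base∪U ext p q Dpq | ⊆-base∪U ext q p Dqp
    ... | inj₁ Xpq | inj₁ Xqp = not-¬ Xqp (antiX p q Xpq)
    ... | inj₁ Xpq | inj₂ u = not-¬ Xpq (proj₂ (proj₂ u))
    ... | inj₂ u | inj₁ Xqp = not-¬ Xqp (proj₂ (proj₂ u))
    ... | inj₂ u | inj₂ u′ =
      not-¬ (a⁺-image D u′ Dqp) (antiH (f p) (f q) (a⁺-image D u Dpq))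

  sink-reflect : ∀ D {v} → X ⊆ D → InU G X v → ¬ Tail G X v →
                 Sink H (a⁺ D) (f v) → Sink G D v
  sink-reflect D {v} X⊆D v∈U ¬tail sink p pv with marked-or-UArrow G X pv
  ... | inj₁ Xpv = X⊆D p v Xpv
  ... | inj₂ (inj₁ Xvp) = contradiction (v∈U , p , Xvp) ¬tail
  ... | inj₂ (inj₂ u) = a⁺-reflects D u (sink (f p) (proj₁ (f-UArrow u)))

  source-reflect : ∀ D {v} → X ⊆ D → InU G X v → ¬ Head G X v →
                   Source H (a⁺ D) (f v) → Source G D v
  source-reflect D {v} X⊆D v∈U ¬head source p vp with marked-or-UArrow G X vp
  ... | inj₁ Xvp = X⊆D v p Xvp
  ... | inj₂ (inj₁ Xpv) = contradiction (v∈U , p , Xpv) ¬head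
  ... | inj₂ (inj₂ u) = a⁺-reflects D u (source (f p) (proj₁ (f-UArrow u)))

  a⁺-⊆ : ∀ {D D′} → Extends G X D → X ⊆ D′ → a⁺ D ≐[ H ] a⁺ D′ → D ⊆ D′
  a⁺-⊆ {D} {D′} ext X⊆D′ a⁺D≐ p q Dpq with ⊆-base∪U ext p q Dpq
  ... | inj₁ Xpq = X⊆D′ p q Xpq
  ... | inj₂ u = a⁺-reflects D′ u (trans (sym (a⁺D≐ (f p) (f q))) (a⁺-image D u Dpq))

module StateCorrespondence
  (G H : Graph) (X : PairSet G) (Y : PairSet H)
  (sX : IsState G X) (sY : IsState H Y) (f : V G → V H)
  (iso : GraphIsoU G H X Y f) (bij : ArrowBij G H X Y (af G H f))
  (heads : ImageCond G H X Y f (Head G X) (Head H Y))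
  (tails : ImageCond G H X Y f (Tail G X) (Tail H Y)) where

  open ArrowImage G H X Y f bij public

  private
    f-InU : ∀ {v} → InU G X v → InU H Y (f v)
    f-InU = proj₁ iso _

    f-injective : ∀ {v v′} → InU G X v → InU G X v′ → f v ≡ f v′ → v ≡ v′
    f-injective = proj₁ (proj₂ iso) _ _

    f-onto : ∀ {u} → InU H Y u → ∃ λ v → InU G X v × f v ≡ u
    f-onto = proj₁ (proj₂ (proj₂ iso)) _

  imageCond-at : ∀ {S S′} → ImageCond G H X Y f S S′ → ∀ {v} → InU G X v →
                 (S v ⊎ Leaf G v) ⇔ (S′ (f v) ⊎ Leaf H (f v))
  imageCond-at {S} cond {v} v∈U = mk⇔
    (λ s → proj₂ (Equivalence.to (cond (f v)) (v , v∈U , s , refl)))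
    (λ s′ → pullback (Equivalence.from (cond (f v)) (f-InU v∈U , s′)))
    where
    pullback : (∃ λ v′ → InU G X v′ × (S v′ ⊎ Leaf G v′) × f v′ ≡ f v) → S v ⊎ Leaf G v
    pullback (v′ , v′∈U , s , eq) = subst (λ x → S x ⊎ Leaf G x) (f-injective v′∈U v∈U eq) s

  imageCond-reflects : ∀ {S S′} → ImageCond G H X Y f S S′ → ∀ {v} → InU G X v →
                       ¬ S′ (f v) → Internal H (f v) → ¬ S v × Internal G v
  imageCond-reflects {S} cond {v} v∈U ¬s′ int =
    neither ∘ inj₁ , neither ∘ inj₂
    where
    neither : ¬ (S v ⊎ Leaf G v)
    neither = [ ¬s′ , int ] ∘ Equivalence.to (imageCond-at cond v∈U)

  imageCond-preserves : ∀ {S S′} → ImageCond G H X Y f S S′ → ∀ {v} → InU G X v →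
                        ¬ S v → Internal G v → ¬ S′ (f v) × Internal H (f v)
  imageCond-preserves {S′ = S′} cond {v} v∈U ¬s int =
    neither ∘ inj₁ , neither ∘ inj₂
    where
    neither : ¬ (S′ (f v) ⊎ Leaf H (f v))
    neither = [ ¬s , int ] ∘ Equivalence.from (imageCond-at cond v∈U)

  sink-preserve : ∀ D {v} → InU G X v → ¬ Tail H Y (f v) → Sink G D v → Sink H (a⁺ D) (f v)
  sink-preserve D {v} v∈U ¬tail sink p pfv with marked-or-UArrow H Y pfv
  ... | inj₁ Ypfv = Y⊆a⁺ D p (f v) Ypfv
  ... | inj₂ (inj₁ Yfvp) = contradiction (f-InU v∈U , p , Yfvp) ¬tail
  ... | inj₂ (inj₂ uY) with proj₂ (proj₂ bij) p (f v) uY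
  ... | v′ , w′ , u , eq with cong proj₁ eq | f-injective (v′ , UArrow-sym G X u) v∈U (cong proj₂ eq)
  ... | refl | refl = a⁺-image D u (sink v′ (proj₁ u))

  source-preserve : ∀ D {v} → InU G X v → ¬ Head H Y (f v) → Source G D v → Source H (a⁺ D) (f v)
  source-preserve D {v} v∈U ¬head source p fvp with marked-or-UArrow H Y fvp
  ... | inj₁ Yfvp = Y⊆a⁺ D (f v) p Yfvp
  ... | inj₂ (inj₁ Ypfv) = contradiction (f-InU v∈U , p , Ypfv) ¬head
  ... | inj₂ (inj₂ uY) with proj₂ (proj₂ bij) (f v) p uY
  ... | v′ , w′ , u , eq with f-injective (w′ , u) v∈U (cong proj₁ eq) | cong proj₂ eq
  ... | refl | refl = a⁺-image D u (source w′ (proj₁ u))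

  a⁺-state : ∀ {D} → Extends G X D → IsState G D → IsState H (a⁺ D)
  a⁺-state {D} ext (decD , noSinkSourceD) = decH , λ u int → no-sink u int , no-source u int
    where
    decH = a⁺-decoration (proj₁ sY) decD
    no-sink : ∀ u → Internal H u → ¬ Sink H (a⁺ D) u
    no-sink u int sink with InU? H Y u
    ... | no u∉U = proj₁ (proj₂ sY u int) (sink-outside-U H decH (Y⊆a⁺ D) u∉U sink)
    ... | yes u∈U with f-onto u∈U
    ... | v , v∈U , refl =
      let ¬tail , intv = imageCond-reflects tails v∈U (Sink⇒¬Tail H decH (Y⊆a⁺ D) sink) int
      in proj₁ (noSinkSourceD v intv) (sink-reflect D (base-⊆ ext) v∈U ¬tail sink)
    no-source : ∀ u → Internal H u → ¬ Source H (a⁺ D) u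
    no-source u int source with InU? H Y u
    ... | no u∉U = proj₂ (proj₂ sY u int) (source-outside-U H decH (Y⊆a⁺ D) u∉U source)
    ... | yes u∈U with f-onto u∈U
    ... | v , v∈U , refl =
      let ¬head , intv = imageCond-reflects heads v∈U (Source⇒¬Head H decH (Y⊆a⁺ D) source) int
      in proj₂ (noSinkSourceD v intv) (source-reflect D (base-⊆ ext) v∈U ¬head source)

  a⁺-state⁻¹ : ∀ {D} → Extends G X D → IsState H (a⁺ D) → IsState G D
  a⁺-state⁻¹ {D} ext (decH , noSinkSourceH) = decD , λ v int → no-sink v int , no-source v int
    where
    decD = a⁺-decoration⁻¹ (proj₁ sX) ext decH
    no-sink : ∀ v → Internal G v → ¬ Sink G D v
    no-sink v int sink with InU? G X v
    ... | no v∉U = proj₁ (proj₂ sX v int) (sink-outside-U G decD (base-⊆ ext) v∉U sink)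
    ... | yes v∈U =
      let ¬tail , intfv = imageCond-preserves tails v∈U (Sink⇒¬Tail G decD (base-⊆ ext) sink) int
      in proj₁ (noSinkSourceH (f v) intfv) (sink-preserve D v∈U ¬tail sink)
    no-source : ∀ v → Internal G v → ¬ Source G D v
    no-source v int source with InU? G X v
    ... | no v∉U = proj₂ (proj₂ sX v int) (source-outside-U G decD (base-⊆ ext) v∉U source)
    ... | yes v∈U =
      let ¬head , intfv = imageCond-preserves heads v∈U (Source⇒¬Head G decD (base-⊆ ext) source) int
      in proj₂ (noSinkSourceH (f v) intfv) (source-preserve D v∈U ¬head source)

  a⁺-follower : ∀ {W Z} → Extends G X W → Follower G W Z → Follower H (a⁺ W) (a⁺ Z)
  a⁺-follower {W} ext (stZ , v , w , uW@(_ , Wvw , Wwv) , Z≐) =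
    a⁺-state (Extends-step G ext uX Z≐) stZ , f v , f w ,
    (proj₁ (f-UArrow uX) , a⁺-unmarked W uX Wvw , a⁺-unmarked W (UArrow-sym G X uX) Wwv) ,
    a⁺-addArrow uX Z≐
    where uX = UArrow-antitone G (base-⊆ ext) uW

  a⁺-desc : ∀ {D} → Desc G X D → Desc H Y (a⁺ D)
  a⁺-desc (step fol) = step (Follower-respˡ-≐ H a⁺-base (a⁺-follower (Extends-refl G) fol))
  a⁺-desc (more d fol) = more (a⁺-desc d) (a⁺-follower (Desc⇒Extends G d) fol)

  a⁺-desc-injective : ∀ D D′ → Desc G X D → Desc G X D′ →
                      a⁺ D ≐[ H ] a⁺ D′ → D ≐[ G ] D′
  a⁺-desc-injective _ _ d d′ a⁺D≐ p q =
    ≡true-ext (a⁺-⊆ ext (base-⊆ ext′) a⁺D≐ p q)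
              (a⁺-⊆ ext′ (base-⊆ ext) (λ p′ q′ → sym (a⁺D≐ p′ q′)) p q)
    where
    ext = Desc⇒Extends G d
    ext′ = Desc⇒Extends G d′

  follower-lift : ∀ {D W Z} → Extends G X D → a⁺ D ≐[ H ] W → Follower H W Z →
                  ∃₂ λ v w → Follower G D (addArrow D v w) × a⁺ (addArrow D v w) ≐[ H ] Z
  follower-lift {D} {W} {Z} ext a⁺D≐W (stZ , v′ , w′ , uW@(_ , Wv′w′ , Ww′v′) , Z≐)
    with proj₂ (proj₂ bij) v′ w′ (UArrow-antitone H Y⊆W uW)
    where Y⊆W = λ p q → trans (sym (a⁺D≐W p q)) ∘ Y⊆a⁺ D p q
  ... | v , w , uX , refl = v , w , (stD′ , v , w , uD , λ _ _ → refl) , a⁺D′≐Z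
    where
    unmarkedD : ∀ {p q} → UArrow G X p q → W (f p) (f q) ≡ false → D p q ≡ false
    unmarkedD u Wfpfq = ¬-not λ Dpq → not-¬ (trans (sym (a⁺D≐W _ _)) (a⁺-image D u Dpq)) Wfpfq
    uD : UArrow G D v w
    uD = proj₁ uX , unmarkedD uX Wv′w′ , unmarkedD (UArrow-sym G X uX) Ww′v′
    a⁺D′≐Z : a⁺ (addArrow D v w) ≐[ H ] Z
    a⁺D′≐Z p q = trans (a⁺-addArrow {D} uX (λ _ _ → refl) p q)
                       (trans (cong (_∨ _) (a⁺D≐W p q)) (sym (Z≐ p q)))
    stD′ : IsState G (addArrow D v w)
    stD′ = a⁺-state⁻¹ (Extends-step G ext uX (λ _ _ → refl))
                      (IsState-resp-≐ H (λ p q → sym (a⁺D′≐Z p q)) stZ)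

  a⁺-desc-onto : ∀ Z → Desc H Y Z → ∃ λ D → Desc G X D × a⁺ D ≐[ H ] Z
  a⁺-desc-onto Z (step fol) with follower-lift (Extends-refl G) a⁺-base fol
  ... | v , w , fol′ , a⁺D≐Z = addArrow X v w , step fol′ , a⁺D≐Z
  a⁺-desc-onto Z (more dW fol) with a⁺-desc-onto _ dW
  ... | D , dD , a⁺D≐W with follower-lift (Desc⇒Extends G dD) a⁺D≐W fol
  ... | v , w , fol′ , a⁺D′≐Z = addArrow D v w , more dD fol′ , a⁺D′≐Z

mainTheorem5 : (G H : Graph) (X : PairSet G) (Y : PairSet H) →
    IsState G X → IsState H Y →
    (f : V G → V H) → GraphIsoU G H X Y f →
    ArrowBij G H X Y (af G H f) →
    ImageCond G H X Y f (Head G X) (Head H Y) →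
    ImageCond G H X Y f (Tail G X) (Tail H Y) →
    StateIso G H X Y (af G H f)
mainTheorem5 G H X Y sX sY f iso bij heads tails =
  bij , (λ _ _ _ → refl) , (λ _ → a⁺-desc) , a⁺-desc-injective , a⁺-desc-onto
  where open StateCorrespondence G H X Y sX sY f iso bij heads tails
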